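{- Let $G$ be a finite simple chordal graph with an S-labeling $v_1,\dots,v_m$ of its vertices, and let $\widetilde G$ be obtained from $G$ by adding a new vertex $v_0$ adjacent to all of $v_1,\dots,v_m$. Then $v_0,v_1,\dots,v_m$ is an S-labeling of $\widetilde G$, and the derived S-graph of $\widetilde G$ for this S-labeling is isomorphic to $G$.
   Context: A graph is chordal if every cycle of length at least four has a chord. An S-labeling of a graph $H$ is a linear order $u_1,\dots,u_k$ of its vertices such that for every $i\ge 2$ the neighbors of $u_i$ among $u_1,\dots,u_{i-1}$ form a clique. For a connected graph $H$ with S-labeling $u_1,\dots,u_k$, its cycle matroid $M(H)$ (on the edge set, circuits = edge sets of cycles) is supersolvable with $M$-chain $F_j=$ set of edges with both endpoints in $\{u_1,\dots,u_{j+1}\}$, $j=0,\dots,k-1$, and associated $M$-partition $P_j=F_j\setminus F_{j-1}$ ($j=1,\dots,k-1$), i.e., $P_j$ is the set of edges joining $u_{j+1}$ to earlier vertices. The derived S-graph of $H$ for this S-labeling is the graph with vertex set $\{P_1,\dots,P_{k-1}\}$ in which $\{P_i,P_j\}$ ($i\neq j$) is an edge iff some nontrivial line of $M(H)$ (a rank-2 flat with at least three elements, i.e. the edge set of a triangle of $H$) meets both $P_i$ and $P_j$. -}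

module Defs where

open import Data.Nat using (ℕ; zero; suc)
open import Data.Fin using (Fin; zero; suc; _<_; inject₁; fromℕ)
open import Data.Fin.Permutation using (Permutation′; _⟨$⟩ʳ_; lift₀)
open import Data.Product using (Σ; ∃; ∃-syntax; _×_; _,_)
open import Data.Sum using (_⊎_)
open import Data.Empty using (⊥)
open import Data.Unit using (⊤)
open import Relation.Nullary using (¬_)
open import Relation.Binary.PropositionalEquality using (_≡_; _≢_)
open import Function.Bundles using (_⇔_)

record SimpleGraph (n : ℕ) : Set₁ where
  field
    Adj    : Fin n → Fin n → Set
    sym    : ∀ {x y} → Adj x y → Adj y x
    irrefl : ∀ {x} → ¬ Adj x x
open SimpleGraph public

record Cycle {n : ℕ} (G : SimpleGraph n) (k : ℕ) : Set where
  field
    vert      : Fin (suc k) → Fin n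
    distinct  : ∀ i j → vert i ≡ vert j → i ≡ j
    step      : ∀ (i : Fin k) → Adj G (vert (inject₁ i)) (vert (suc i))
    close     : Adj G (vert (fromℕ k)) (vert zero)

Consecutive : {k : ℕ} → Fin (suc k) → Fin (suc k) → Set
Consecutive {k} i j =
  (Σ (Fin k) λ t → (i ≡ inject₁ t × j ≡ suc t) ⊎ (j ≡ inject₁ t × i ≡ suc t))
  ⊎ ((i ≡ fromℕ k × j ≡ zero) ⊎ (j ≡ fromℕ k × i ≡ zero))

HasChord : {n k : ℕ} {G : SimpleGraph n} → Cycle G k → Set
HasChord {k = k} {G} C =
  Σ (Fin (suc k)) λ i → Σ (Fin (suc k)) λ j →
    i ≢ j × ¬ Consecutive i j × Adj G (Cycle.vert C i) (Cycle.vert C j)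

Chordal : {n : ℕ} → SimpleGraph n → Set
Chordal G = ∀ k → (C : Cycle G (suc (suc (suc k)))) → HasChord C

-- A linear order of the vertices is given by a permutation σ:
-- position p (0-indexed) holds vertex σ p, i.e. u_{p+1} = σ ⟨$⟩ʳ p.
-- S-labeling: for each position i, the earlier neighbours of σ i are
-- pairwise adjacent (form a clique).
IsSLabeling : {n : ℕ} → SimpleGraph n → Permutation′ n → Set
IsSLabeling G σ =
  ∀ (i j l : Fin _) → j < i → l < i → j ≢ l →
    Adj G (σ ⟨$⟩ʳ i) (σ ⟨$⟩ʳ j) → Adj G (σ ⟨$⟩ʳ i) (σ ⟨$⟩ʳ l) →
    Adj G (σ ⟨$⟩ʳ j) (σ ⟨$⟩ʳ l)

coneAdj : {m : ℕ} → SimpleGraph m → Fin (suc m) → Fin (suc m) → Set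
coneAdj G zero    zero    = ⊥
coneAdj G zero    (suc y) = ⊤
coneAdj G (suc x) zero    = ⊤
coneAdj G (suc x) (suc y) = Adj G x y

coneSym : {m : ℕ} (G : SimpleGraph m) {x y : Fin (suc m)} →
          coneAdj G x y → coneAdj G y x
coneSym G {zero}  {zero}  ()
coneSym G {zero}  {suc y} p = p
coneSym G {suc x} {zero}  p = p
coneSym G {suc x} {suc y} p = sym G p

coneIrrefl : {m : ℕ} (G : SimpleGraph m) {x : Fin (suc m)} → ¬ coneAdj G x x
coneIrrefl G {zero}  ()
coneIrrefl G {suc x} p = irrefl G p

cone : {m : ℕ} → SimpleGraph m → SimpleGraph (suc m)
cone G = record { Adj = coneAdj G ; sym = λ {x} {y} → coneSym G {x} {y} ; irrefl = λ {x} → coneIrrefl G {x} }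

coneLabeling : {m : ℕ} → Permutation′ m → Permutation′ (suc m)
coneLabeling σ = lift₀ σ

-- M-partition block P_a of M(H) for the labeling σ of H on k+1 vertices
-- (a : Fin k stands for P_{a+1}): the edges joining u_{a+2} = σ (suc a)
-- to an earlier vertex.
InBlock : {k : ℕ} → Permutation′ (suc k) → Fin k → Fin (suc k) → Fin (suc k) → Set
InBlock σ a s t =
  (s ≡ σ ⟨$⟩ʳ suc a × Σ (Fin _) λ q → q < suc a × t ≡ σ ⟨$⟩ʳ q)
  ⊎ (t ≡ σ ⟨$⟩ʳ suc a × Σ (Fin _) λ q → q < suc a × s ≡ σ ⟨$⟩ʳ q)

-- The triangle {x,y,z} (its edge set, a nontrivial line of M(H)) meets P_a.
TriangleMeets : {k : ℕ} → Permutation′ (suc k) → Fin k →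
                Fin (suc k) → Fin (suc k) → Fin (suc k) → Set
TriangleMeets σ a x y z = InBlock σ a x y ⊎ InBlock σ a y z ⊎ InBlock σ a x z

DerivedAdj : {k : ℕ} → SimpleGraph (suc k) → Permutation′ (suc k) →
             Fin k → Fin k → Set
DerivedAdj H σ a b =
  a ≢ b ×
  Σ (Fin _) λ x → Σ (Fin _) λ y → Σ (Fin _) λ z →
    Adj H x y × Adj H y z × Adj H x z ×
    TriangleMeets σ a x y z × TriangleMeets σ b x y z

Isomorphic : {n : ℕ} → (Fin n → Fin n → Set) → (Fin n → Fin n → Set) → Set
Isomorphic {n} R S =
  Σ (Permutation′ n) λ f → ∀ x y → R x y ⇔ S (f ⟨$⟩ʳ x) (f ⟨$⟩ʳ y)

-- The apex v₀ sits at position 0, so for every later vertex u the edge {v₀, u} lies in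
-- the block of u.  Hence two adjacent vertices u, w of G give the triangle {v₀, u, w}
-- meeting the blocks of u and of w.  Conversely, every edge of a block contains the
-- block's own vertex, so a triangle meeting the blocks of two distinct vertices contains
-- both of them, and these are adjacent.  Thus u ↦ (block of u) is an isomorphism.
module Submission where

open import Defs
open import Data.Nat as ℕ using (ℕ; s≤s; z≤n)
open import Data.Fin using (Fin; zero; suc)
open import Data.Fin.Properties using (suc-injective)
open import Data.Fin.Permutation
  using (Permutation; Permutation′; _⟨$⟩ʳ_; _⟨$⟩ˡ_; flip; inverseʳ; inverseˡ)
open import Data.Product using (_×_; _,_)
open import Data.Sum using (_⊎_; inj₁; inj₂)
open import Data.Unit using (tt)
open import Data.Empty using (⊥-elim)
open import Function using (_∘_)
open import Function.Bundles using (_⇔_; mk⇔)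
open import Relation.Binary.PropositionalEquality
  using (_≡_; _≢_; refl; cong; trans; subst₂)
  renaming (sym to ≡-sym)

⟨$⟩ʳ-injective : ∀ {m n} (π : Permutation m n) {i j : Fin m} →
                 π ⟨$⟩ʳ i ≡ π ⟨$⟩ʳ j → i ≡ j
⟨$⟩ʳ-injective π e = trans (≡-sym (inverseˡ π)) (trans (cong (π ⟨$⟩ˡ_) e) (inverseˡ π))

isomorphic-by-relabeling : ∀ {n} {R S : Fin n → Fin n → Set} (π : Permutation′ n) →
  (∀ a b → R (π ⟨$⟩ʳ a) (π ⟨$⟩ʳ b) ⇔ S a b) → Isomorphic R S
isomorphic-by-relabeling {R = R} {S} π R∘π⇔S = flip π , λ x y →
  subst₂ (λ u v → R u v ⇔ S (π ⟨$⟩ˡ x) (π ⟨$⟩ˡ y))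
         (inverseʳ π) (inverseʳ π) (R∘π⇔S (π ⟨$⟩ˡ x) (π ⟨$⟩ˡ y))

cone-isSLabeling : ∀ {m} (G : SimpleGraph m) (σ : Permutation′ m) →
  IsSLabeling G σ → IsSLabeling (cone G) (coneLabeling σ)
cone-isSLabeling G σ S zero    _       _       ()
cone-isSLabeling G σ S (suc i) zero    zero    _       _       j≢l = ⊥-elim (j≢l refl)
cone-isSLabeling G σ S (suc i) zero    (suc l) _       _       _   _  _  = tt
cone-isSLabeling G σ S (suc i) (suc j) zero    _       _       _   _  _  = tt
cone-isSLabeling G σ S (suc i) (suc j) (suc l) (s≤s j<i) (s≤s l<i) j≢l =
  S i j l j<i l<i (j≢l ∘ cong suc)

OneOf : ∀ {n} → Fin n → Fin n → Fin n → Fin n → Set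
OneOf u x y z = u ≡ x ⊎ u ≡ y ⊎ u ≡ z

triangle-adj : ∀ {n} (H : SimpleGraph n) {x y z u v : Fin n} →
  Adj H x y → Adj H y z → Adj H x z →
  OneOf u x y z → OneOf v x y z → u ≢ v → Adj H u v
triangle-adj H xy yz xz (inj₁ refl)        (inj₁ refl)        u≢v = ⊥-elim (u≢v refl)
triangle-adj H xy yz xz (inj₁ refl)        (inj₂ (inj₁ refl)) _   = xy
triangle-adj H xy yz xz (inj₁ refl)        (inj₂ (inj₂ refl)) _   = xz
triangle-adj H xy yz xz (inj₂ (inj₁ refl)) (inj₁ refl)        _   = sym H xy
triangle-adj H xy yz xz (inj₂ (inj₁ refl)) (inj₂ (inj₁ refl)) u≢v = ⊥-elim (u≢v refl)
triangle-adj H xy yz xz (inj₂ (inj₁ refl)) (inj₂ (inj₂ refl)) _   = yz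
triangle-adj H xy yz xz (inj₂ (inj₂ refl)) (inj₁ refl)        _   = sym H xz
triangle-adj H xy yz xz (inj₂ (inj₂ refl)) (inj₂ (inj₁ refl)) _   = sym H yz
triangle-adj H xy yz xz (inj₂ (inj₂ refl)) (inj₂ (inj₂ refl)) u≢v = ⊥-elim (u≢v refl)

inBlock-contains-top : ∀ {k} (σ : Permutation′ (ℕ.suc k)) (a : Fin k) {s t} →
  InBlock σ a s t → σ ⟨$⟩ʳ suc a ≡ s ⊎ σ ⟨$⟩ʳ suc a ≡ t
inBlock-contains-top σ a (inj₁ (s≡top , _)) = inj₁ (≡-sym s≡top)
inBlock-contains-top σ a (inj₂ (t≡top , _)) = inj₂ (≡-sym t≡top)

triangleMeets-contains-top : ∀ {k} (σ : Permutation′ (ℕ.suc k)) (a : Fin k) {x y z} →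
  TriangleMeets σ a x y z → OneOf (σ ⟨$⟩ʳ suc a) x y z
triangleMeets-contains-top σ a (inj₁ xy) with inBlock-contains-top σ a xy
... | inj₁ e = inj₁ e
... | inj₂ e = inj₂ (inj₁ e)
triangleMeets-contains-top σ a (inj₂ (inj₁ yz)) = inj₂ (inBlock-contains-top σ a yz)
triangleMeets-contains-top σ a (inj₂ (inj₂ xz)) with inBlock-contains-top σ a xz
... | inj₁ e = inj₁ e
... | inj₂ e = inj₂ (inj₂ e)

derivedAdj⇒adj-top : ∀ {k} (H : SimpleGraph (ℕ.suc k)) (σ : Permutation′ (ℕ.suc k)) {a b} →
  DerivedAdj H σ a b → Adj H (σ ⟨$⟩ʳ suc a) (σ ⟨$⟩ʳ suc b)
derivedAdj⇒adj-top H σ {a} {b} (a≢b , x , y , z , xy , yz , xz , meets-a , meets-b) =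
  triangle-adj H xy yz xz
    (triangleMeets-contains-top σ a meets-a)
    (triangleMeets-contains-top σ b meets-b)
    (a≢b ∘ suc-injective ∘ ⟨$⟩ʳ-injective σ)

apex-inBlock : ∀ {m} (σ : Permutation′ m) (a : Fin m) →
  InBlock (coneLabeling σ) a zero (suc (σ ⟨$⟩ʳ a))
apex-inBlock σ a = inj₂ (refl , zero , s≤s z≤n , refl)

adj⇒cone-derivedAdj : ∀ {m} (G : SimpleGraph m) (σ : Permutation′ m) {a b} →
  Adj G (σ ⟨$⟩ʳ a) (σ ⟨$⟩ʳ b) → DerivedAdj (cone G) (coneLabeling σ) a b
adj⇒cone-derivedAdj G σ {a} {b} σa~σb =
  a≢b , zero , suc (σ ⟨$⟩ʳ a) , suc (σ ⟨$⟩ʳ b) , tt , σa~σb , tt ,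
  inj₁ (apex-inBlock σ a) , inj₂ (inj₂ (apex-inBlock σ b))
  where
  a≢b : a ≢ b
  a≢b refl = irrefl G σa~σb

cone-derivedAdj⇔adj : ∀ {m} (G : SimpleGraph m) (σ : Permutation′ m) a b →
  Adj G (σ ⟨$⟩ʳ a) (σ ⟨$⟩ʳ b) ⇔ DerivedAdj (cone G) (coneLabeling σ) a b
cone-derivedAdj⇔adj G σ a b =
  mk⇔ (adj⇒cone-derivedAdj G σ) (derivedAdj⇒adj-top (cone G) (coneLabeling σ))

proposition2p13 : (m : ℕ) (G : SimpleGraph m) (σ : Permutation′ m) →
    Chordal G → IsSLabeling G σ →
    IsSLabeling (cone G) (coneLabeling σ)
      × Isomorphic (Adj G) (DerivedAdj (cone G) (coneLabeling σ))
proposition2p13 m G σ _ S =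
  cone-isSLabeling G σ S , isomorphic-by-relabeling σ (cone-derivedAdj⇔adj G σ)
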